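{- For partial orders $\langle R,X\rangle$ and $\langle S,Y\rangle$ with $X\cap Y=\emptyset$, $L(\langle R,X\rangle+\langle S,Y\rangle)=L\langle R,X\rangle+L\langle S,Y\rangle$, where the $+$ on the right is the (linear-order) shuffle sum.
   Context: A relation on $X$ is a pair $\langle R,X\rangle$ with $R\subseteq X^2$. For $X\cap Y=\emptyset$, $\langle R,X\rangle+\langle S,Y\rangle=\langle R\cup S,X\cup Y\rangle$. Partial orders are strict (irreflexive and transitive); a linear order is a partial order in which any two distinct elements are comparable. A relationship on $X$ is a pair $[U,X]$ with $U\subseteq\mathcal P(X^2)$. For a partial order $\langle R,X\rangle$, $L\langle R,X\rangle=[\{R'\subseteq X^2\mid R\subseteq R',\ \langle R',X\rangle\text{ a linear order}\},X]$. For relationships $[U,X],[V,Y]$ with $X\cap Y=\emptyset$, the shuffle sum is $[U,X]+[V,Y]=[\{Q\subseteq(X\cup Y)^2\mid \langle Q,X\cup Y\rangle\text{ is a linear order and }\exists R\in U\,\exists S\in V\,(Q\cap X^2=R\ \&\ Q\cap Y^2=S)\},X\cup Y]$. -}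

module Defs where

open import Level using (Level; 0ℓ; Lift) renaming (suc to lsuc)
open import Data.Product using (_×_; Σ; ∃; _,_)
open import Data.Sum using (_⊎_)
open import Data.Empty using (⊥)
open import Relation.Nullary using (¬_)
open import Relation.Unary using (Pred)
open import Relation.Binary.Core using (Rel)
open import Relation.Binary.PropositionalEquality using (_≡_)
open import Function.Bundles using (_⇔_)

Subset : Set → Set₁
Subset A = Pred A 0ℓ

BinRel : Set → Set₁
BinRel A = Rel A 0ℓ

record Relation (A : Set) : Set₁ where
  constructor ⟨_,_⟩
  field
    rel     : BinRel A
    carrier : Subset A
open Relation public

_⊆²_ : {A : Set} → BinRel A → Subset A → Set
_⊆²_ {A} R X = ∀ (a b : A) → R a b → X a × X b

Disjoint : {A : Set} → Subset A → Subset A → Set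
Disjoint {A} X Y = ∀ (a : A) → X a → Y a → ⊥

record IsPartialOrder {A : Set} (P : Relation A) : Set where
  field
    within : rel P ⊆² carrier P
    irrefl : ∀ a → carrier P a → ¬ rel P a a
    trans  : ∀ a b c → rel P a b → rel P b c → rel P a c

record IsLinearOrder {A : Set} (P : Relation A) : Set where
  field
    isPartialOrder : IsPartialOrder P
    total : ∀ a b → carrier P a → carrier P b → ¬ (a ≡ b) → rel P a b ⊎ rel P b a

-- Sum of relations with disjoint carriers (disjointness is a hypothesis of use)
_⊕_ : {A : Set} → Relation A → Relation A → Relation A
⟨ R , X ⟩ ⊕ ⟨ S , Y ⟩ = ⟨ (λ a b → R a b ⊎ S a b) , (λ a → X a ⊎ Y a) ⟩

record Relationship (A : Set) : Set₂ where
  constructor [_,_]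
  field
    family : Pred (BinRel A) (lsuc 0ℓ)
    base   : Subset A
open Relationship public

L : {A : Set} → Relation A → Relationship A
L {A} ⟨ R , X ⟩ =
  [ (λ R' → Lift (lsuc 0ℓ) ((R' ⊆² X) × (∀ a b → R a b → R' a b) × IsLinearOrder ⟨ R' , X ⟩)) , X ]

_∩²_≐_ : {A : Set} → BinRel A → Subset A → BinRel A → Set
_∩²_≐_ {A} Q X R = ∀ (a b : A) → (Q a b × X a × X b) ⇔ R a b

_⊞_ : {A : Set} → Relationship A → Relationship A → Relationship A
_⊞_ {A} [ U , X ] [ V , Y ] =
  [ (λ Q → (Q ⊆² (λ a → X a ⊎ Y a))
           × IsLinearOrder ⟨ Q , (λ a → X a ⊎ Y a) ⟩
           × Σ (BinRel A) (λ R → Σ (BinRel A) (λ S →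
               U R × V S × (Q ∩² X ≐ R) × (Q ∩² Y ≐ S))))
  , (λ a → X a ⊎ Y a) ]

_≈R_ : {A : Set} → Relationship A → Relationship A → Set₁
_≈R_ {A} 𝓤 𝓥 = (∀ (a : A) → base 𝓤 a ⇔ base 𝓥 a) × (∀ (Q : BinRel A) → family 𝓤 Q ⇔ family 𝓥 Q)

-- Both relationships live on the carrier X ∪ Y, so only the families need
-- comparing.  The whole argument is about restriction Q ↾ Z = Q ∩ Z²:
--  * restricting a linear order to a subset of its carrier is again a
--    linear order (restrict-linear), and Q ↾ Z is by definition the
--    witness for Q ∩ Z² (restrict-≐);
--  * hence a linear extension Q of R ∪ S restricts to linear extensions
--    Q ↾ X of R and Q ↾ Y of S (restrict-linearExtension), which makes Q a
--    shuffle;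
--  * conversely, if Q ∩ X² = R' with R ⊆ R', then R ⊆ Q (≐-reflects-⊆),
--    so a shuffle of linear extensions of R and S contains R ∪ S.
module Submission where

open import Defs
open import Level using (lift)
open import Data.Product using (_×_; _,_; proj₁)
open import Data.Sum using (_⊎_; inj₁; inj₂) renaming ([_,_] to case⊎)
open import Function.Bundles using (_⇔_; mk⇔; Equivalence)
open import Function using (id)

open IsPartialOrder
open IsLinearOrder

_↾_ : {A : Set} → BinRel A → Subset A → BinRel A
(Q ↾ Z) a b = Q a b × Z a × Z b

restrict-≐ : {A : Set} (Q : BinRel A) (Z : Subset A) → Q ∩² Z ≐ (Q ↾ Z)
restrict-≐ Q Z a b = mk⇔ id id

restrict-within : {A : Set} (Q : BinRel A) (Z : Subset A) → (Q ↾ Z) ⊆² Z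
restrict-within Q Z a b (_ , za , zb) = za , zb

restrict-linear : {A : Set} (Q : BinRel A) (W Z : Subset A) →
  (∀ a → Z a → W a) → IsLinearOrder ⟨ Q , W ⟩ → IsLinearOrder ⟨ Q ↾ Z , Z ⟩
restrict-linear Q W Z Z⊆W lin = record
  { isPartialOrder = record
    { within = restrict-within Q Z
    ; irrefl = λ a za (q , _) → irrefl po a (Z⊆W a za) q
    ; trans  = λ a b c (qab , za , _) (qbc , _ , zc) → trans po a b c qab qbc , za , zc
    }
  ; total = λ a b za zb a≢b →
      case⊎ (λ qab → inj₁ (qab , za , zb)) (λ qba → inj₂ (qba , zb , za))
        (total lin a b (Z⊆W a za) (Z⊆W b zb) a≢b)
  }
  where po = isPartialOrder lin

≐-reflects-⊆ : {A : Set} (Q R' R : BinRel A) (Z : Subset A) →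
  Q ∩² Z ≐ R' → (∀ a b → R a b → R' a b) → ∀ a b → R a b → Q a b
≐-reflects-⊆ Q R' R Z Q∩Z≐R' R⊆R' a b r =
  proj₁ (Equivalence.from (Q∩Z≐R' a b) (R⊆R' a b r))

restrict-linearExtension : {A : Set} (Q R : BinRel A) (W Z : Subset A) →
  (∀ a → Z a → W a) → R ⊆² Z → (∀ a b → R a b → Q a b) →
  IsLinearOrder ⟨ Q , W ⟩ → family (L ⟨ R , Z ⟩) (Q ↾ Z)
restrict-linearExtension Q R W Z Z⊆W R⊆Z² R⊆Q lin =
  lift ( restrict-within Q Z
       , (λ a b r → R⊆Q a b r , R⊆Z² a b r)
       , restrict-linear Q W Z Z⊆W lin )

proposition4p7 : {A : Set} (P Q : Relation A) →
    IsPartialOrder P → IsPartialOrder Q → Disjoint (carrier P) (carrier Q) →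
    L (P ⊕ Q) ≈R (L P ⊞ L Q)
proposition4p7 {A} ⟨ R , X ⟩ ⟨ S , Y ⟩ poR poS _ =
  (λ a → mk⇔ id id) , λ Q → mk⇔ (linearExtension⇒shuffle Q) (shuffle⇒linearExtension Q)
  where
  X∪Y : Subset A
  X∪Y a = X a ⊎ Y a

  linearExtension⇒shuffle : (Q : BinRel A) →
    family (L (⟨ R , X ⟩ ⊕ ⟨ S , Y ⟩)) Q → family (L ⟨ R , X ⟩ ⊞ L ⟨ S , Y ⟩) Q
  linearExtension⇒shuffle Q (lift (Q⊆XY² , R∪S⊆Q , lin)) =
    Q⊆XY² , lin , Q ↾ X , Q ↾ Y
    , restrict-linearExtension Q R X∪Y X (λ _ → inj₁) (within poR) (λ a b r → R∪S⊆Q a b (inj₁ r)) lin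
    , restrict-linearExtension Q S X∪Y Y (λ _ → inj₂) (within poS) (λ a b s → R∪S⊆Q a b (inj₂ s)) lin
    , restrict-≐ Q X , restrict-≐ Q Y

  shuffle⇒linearExtension : (Q : BinRel A) →
    family (L ⟨ R , X ⟩ ⊞ L ⟨ S , Y ⟩) Q → family (L (⟨ R , X ⟩ ⊕ ⟨ S , Y ⟩)) Q
  shuffle⇒linearExtension Q
    (Q⊆XY² , lin , R' , S' , lift (_ , R⊆R' , _) , lift (_ , S⊆S' , _) , Q∩X≐R' , Q∩Y≐S') =
    lift ( Q⊆XY²
         , (λ a b → case⊎ (≐-reflects-⊆ Q R' R X Q∩X≐R' R⊆R' a b) (≐-reflects-⊆ Q S' S Y Q∩Y≐S' S⊆S' a b))
         , lin )
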